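{- Let $r \geq 1$ and $0 \leq k \leq n$ be integers. Then $$\begin{bmatrix} n \\ k \end{bmatrix}_q = \sum_{v \in \Omega^{r}_{n,k}} q^{\operatorname{inv}(v)} \cdot \begin{bmatrix} r \\ 1 \end{bmatrix}_q^{b_1(v)} \cdot \begin{bmatrix} r \\ 2 \end{bmatrix}_q^{b_2(v)} \cdots \begin{bmatrix} r \\ \lfloor r/2\rfloor \end{bmatrix}_q^{b_{\lfloor r/2\rfloor}(v)}.$$
   Context: $\begin{bmatrix} n \\ k \end{bmatrix}_q = \frac{[n]_q!}{[k]_q!\,[n-k]_q!}$ with $[m]_q! = \prod_{i=1}^m (1+q+\cdots+q^{i-1})$ is the Gaussian coefficient. $\Omega_{n,k}$ is the set of words $v=v_1\cdots v_n$ over $\{0,1\}$ with $n-k$ zeroes and $k$ ones. $\Omega^r_{n,k}$ is the set of $v \in \Omega_{n,k}$ satisfying $v_{rj-r+1} \leq v_{rj-r+2} \leq \cdots \leq v_{rj}$ for every $j = 1, \ldots, \lfloor n/r \rfloor$ (no condition on the last $n - r\lfloor n/r\rfloor$ entries). $\operatorname{inv}(v) = |\{(i,j): 1 \leq i<j\leq n,\ v_i>v_j\}|$. For $1 \leq i \leq \lfloor r/2 \rfloor$, $b_i(v) = |\{ j \in \{1,\ldots,\lfloor n/r\rfloor\} : v_{rj-r+1} + v_{rj-r+2} + \cdots + v_{rj} \in \{i, r-i\}\}|$. -}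

module Defs where

open import Data.Nat using (ℕ; zero; suc; _+_; _*_; _∸_; _^_; _≤ᵇ_; _<ᵇ_; _≡ᵇ_)
open import Data.Nat.DivMod using (_/_)
open import Data.Bool using (Bool; true; false; _∧_; _∨_; not; if_then_else_)
open import Data.List using (List; []; _∷_; map; upTo; filterᵇ; _++_; length)
open import Data.Nat.ListAction using (sum; product)
open import Data.Vec using (Vec; []; _∷_; lookup)
open import Data.Fin using (Fin; fromℕ<)
open import Data.Nat.Properties using (_<?_)
open import Relation.Nullary using (yes; no)

-- Evaluation of polynomials in q at a natural number q.
-- [m]_q = 1 + q + ... + q^(m-1)
qint : ℕ → ℕ → ℕ
qint m q = sum (map (λ i → q ^ i) (upTo m))

qfact : ℕ → ℕ → ℕ
qfact m q = product (map (λ i → qint (suc i) q) (upTo m))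

-- natural-number division (the denominator is never 0 where used: [m]_q! ≥ 1)
divℕ : ℕ → ℕ → ℕ
divℕ a zero    = 0
divℕ a (suc b) = a / suc b

gauss : ℕ → ℕ → ℕ → ℕ
gauss n k q = divℕ (qfact n q) (qfact k q * qfact (n ∸ k) q)

-- all binary words of length n (true = 1, false = 0)
words : (n : ℕ) → List (Vec Bool n)
words zero    = [] ∷ []
words (suc n) = map (false ∷_) (words n) ++ map (true ∷_) (words n)

-- entry at 0-based position p (false if out of range; never used out of range)
at : {n : ℕ} → Vec Bool n → ℕ → Bool
at {n} v p with p <? n
... | yes p<n = lookup v (fromℕ< p<n)
... | no  _   = false

bit : Bool → ℕ
bit true  = 1
bit false = 0

ones : {n : ℕ} → Vec Bool n → ℕ
ones []       = 0
ones (b ∷ v)  = bit b + ones v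

allᵇ : List Bool → Bool
allᵇ []       = true
allᵇ (b ∷ bs) = b ∧ allᵇ bs

countᵇ : List Bool → ℕ
countᵇ bs = sum (map bit bs)

leB : Bool → Bool → Bool
leB true false = false
leB _    _     = true

-- v ∈ Ω^r_{n,k}: k ones and, for each block j = 1..⌊n/r⌋ (0-based j here),
-- v_{rj+1} ≤ v_{rj+2} ≤ ... ≤ v_{rj+r} (1-based positions; 0-based rj+t, t<r)
inOmega : (r k : ℕ) {n : ℕ} → Vec Bool n → Bool
inOmega r k {n} v =
  (ones v ≡ᵇ k) ∧
  allᵇ (map (λ j → allᵇ (map (λ t → leB (at v (r * j + t)) (at v (r * j + suc t)))
                              (upTo (r ∸ 1))))
            (upTo (divℕ n r)))

inv : {n : ℕ} → Vec Bool n → ℕ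
inv {n} v = sum (map (λ i → countᵇ (map (λ j → (i <ᵇ j) ∧ at v i ∧ not (at v j)) (upTo n)))
                     (upTo n))

-- sum of the j-th block (0-based j): v_{rj+1} + ... + v_{rj+r} (1-based positions)
blockSum : (r : ℕ) {n : ℕ} → Vec Bool n → ℕ → ℕ
blockSum r v j = sum (map (λ t → bit (at v (r * j + t))) (upTo r))

bstat : (r i : ℕ) {n : ℕ} → Vec Bool n → ℕ
bstat r i {n} v = countᵇ (map (λ j → (blockSum r v j ≡ᵇ i) ∨ (blockSum r v j ≡ᵇ (r ∸ i)))
                              (upTo (divℕ n r)))

weight : (r : ℕ) {n : ℕ} → ℕ → Vec Bool n → ℕ
weight r q v = q ^ inv v * product (map (λ i → gauss r (suc i) q ^ bstat r (suc i) v) (upTo (r / 2)))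

rhs : (r n k q : ℕ) → ℕ
rhs r n k q = sum (map (weight r q) (filterᵇ (inOmega r k) (words n)))

-- Both sides are sums over binary words. The left side is the inversion generating function
-- Σ_{|v| = k} q^inv(v) (q-Pascal recursion, then multiply out the q-factorials). Cut a word into
-- its first block u of length r and the rest w: inv(uw) = inv u + ones(u)·zeros(w) + inv w, so for
-- fixed letter counts of u, summing q^inv(u) over all u gives [r choose ones u]_q. The right side
-- keeps only sorted blocks u, weighted by ∏ᵢ [r choose i]_q^[ones u ∈ {i, r - i}], and this weight
-- is again [r choose ones u]_q because [r choose s] = [r choose r - s] and each 0 < s < r lies in
-- exactly one pair {i, r - i} with 1 ≤ i ≤ ⌊r/2⌋. Induct on the number of blocks, letting the
-- summand carry an arbitrary function of the letter counts so that the cross term is absorbed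
-- into the tail.

module Submission where

open import Defs
open import Data.Nat using (ℕ; zero; suc; _+_; _*_; _∸_; _^_; _≤_; _<_; z≤n; s≤s; z<s; s<s; s≤s⁻¹; s<s⁻¹; _<ᵇ_; _≡ᵇ_)
open import Data.Nat.Properties
open import Data.Nat.DivMod using (_/_; _%_; m/n≤m; m≡m%n+[m/n]*n; m%n<n; m*n/n≡m; m<n⇒m/n≡0; m/n≡1+[m∸n]/n)
open import Data.Bool using (Bool; true; false; _∧_; _∨_; not; if_then_else_; T)
open import Data.Bool.Properties using (∨-zeroʳ; ¬-not)
open import Data.Sum using (_⊎_; inj₁; inj₂)
open import Data.List using (List; []; _∷_; map; upTo; applyUpTo; filterᵇ; _++_; [_])
open import Data.List.Properties using (map-cong; map-∘; map-++; map-applyUpTo; map-upTo; upTo-∷ʳ)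
open import Data.Nat.ListAction using (sum; product)
open import Data.Nat.ListAction.Properties using (sum-++; product-++)
open import Data.Vec using (Vec; []; _∷_) renaming (_++_ to _++ᵥ_)
open import Data.Empty using (⊥-elim)
open import Data.Unit using (tt)
open import Function using (_∘_)
open import Data.Nat.Induction using (<-rec)
open import Relation.Nullary using (yes; no)
open import Relation.Binary.PropositionalEquality hiding ([_])
open import Data.Nat.Tactic.RingSolver using (solve-∀)

private variable A B : Set

≡ᵇ≡true⇒≡ : ∀ {m n} → (m ≡ᵇ n) ≡ true → m ≡ n
≡ᵇ≡true⇒≡ {m} {n} eq = ≡ᵇ⇒≡ m n (subst T (sym eq) tt)

≡⇒≡ᵇ≡true : ∀ {m n} → m ≡ n → (m ≡ᵇ n) ≡ true
≡⇒≡ᵇ≡true {m} refl = ≡ᵇ-refl m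
  where
  ≡ᵇ-refl : ∀ m → (m ≡ᵇ m) ≡ true
  ≡ᵇ-refl zero    = refl
  ≡ᵇ-refl (suc m) = ≡ᵇ-refl m

≢⇒≡ᵇ≡false : ∀ {m n} → m ≢ n → (m ≡ᵇ n) ≡ false
≢⇒≡ᵇ≡false {m} {n} m≢n with m ≡ᵇ n in eq
... | false = refl
... | true  = ⊥-elim (m≢n (≡ᵇ≡true⇒≡ eq))

ind : Bool → ℕ → ℕ
ind b x = if b then x else 0

ind-0 : ∀ b → ind b 0 ≡ 0
ind-0 true  = refl
ind-0 false = refl

ind-∧ : ∀ a b x → ind (a ∧ b) x ≡ ind a (ind b x)
ind-∧ true  b x = refl
ind-∧ false b x = refl

ind-*ˡ : ∀ b c x → ind b (c * x) ≡ c * ind b x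
ind-*ˡ true  c x = refl
ind-*ˡ false c x = sym (*-zeroʳ c)

map-upTo-suc : ∀ (f : ℕ → A) n → map f (upTo (suc n)) ≡ f 0 ∷ map (f ∘ suc) (upTo n)
map-upTo-suc f n = trans (map-upTo f (suc n)) (cong (f 0 ∷_) (sym (map-upTo (f ∘ suc) n)))

map-upTo-cong : ∀ {f g : ℕ → A} n → (∀ i → i < n → f i ≡ g i) →
                map f (upTo n) ≡ map g (upTo n)
map-upTo-cong zero    eq = refl
map-upTo-cong {f = f} {g} (suc n) eq = begin
  map f (upTo (suc n))          ≡⟨ map-upTo-suc f n ⟩
  f 0 ∷ map (f ∘ suc) (upTo n)  ≡⟨ cong₂ _∷_ (eq 0 z<s) (map-upTo-cong n λ i i<n → eq (suc i) (s<s i<n)) ⟩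
  g 0 ∷ map (g ∘ suc) (upTo n)  ≡⟨ map-upTo-suc g n ⟨
  map g (upTo (suc n))          ∎
  where open ≡-Reasoning

sum-map-cong : ∀ {f g : A → ℕ} → (∀ x → f x ≡ g x) → ∀ xs → sum (map f xs) ≡ sum (map g xs)
sum-map-cong eq xs = cong sum (map-cong eq xs)

sum-map-++ : ∀ (f : A → ℕ) xs ys → sum (map f (xs ++ ys)) ≡ sum (map f xs) + sum (map f ys)
sum-map-++ f xs ys = trans (cong sum (map-++ f xs ys)) (sum-++ (map f xs) (map f ys))

sum-map-∘ : ∀ (f : B → ℕ) (g : A → B) xs → sum (map f (map g xs)) ≡ sum (map (f ∘ g) xs)
sum-map-∘ f g xs = cong sum (sym (map-∘ xs))

sum-map-zero : ∀ (xs : List A) → sum (map (λ _ → 0) xs) ≡ 0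
sum-map-zero []       = refl
sum-map-zero (x ∷ xs) = sum-map-zero xs

sum-map-+ : ∀ (f g : A → ℕ) xs → sum (map (λ x → f x + g x) xs) ≡ sum (map f xs) + sum (map g xs)
sum-map-+ f g []       = refl
sum-map-+ f g (x ∷ xs) = trans (cong (f x + g x +_) (sum-map-+ f g xs)) (interchange (f x) (g x) _ _)
  where
  interchange : ∀ a b c d → a + b + (c + d) ≡ a + c + (b + d)
  interchange = solve-∀

sum-map-*ˡ : ∀ c (f : A → ℕ) xs → sum (map (λ x → c * f x) xs) ≡ c * sum (map f xs)
sum-map-*ˡ c f []       = sym (*-zeroʳ c)
sum-map-*ˡ c f (x ∷ xs) = trans (cong (c * f x +_) (sum-map-*ˡ c f xs)) (sym (*-distribˡ-+ c (f x) _))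

sum-map-swap : ∀ (g : A → B → ℕ) xs ys →
               sum (map (λ y → sum (map (λ x → g x y) xs)) ys) ≡ sum (map (λ x → sum (map (g x) ys)) xs)
sum-map-swap g []       ys = sum-map-zero ys
sum-map-swap g (x ∷ xs) ys =
  trans (sum-map-+ (g x) _ ys) (cong (sum (map (g x) ys) +_) (sum-map-swap g xs ys))

sum-map-filterᵇ : ∀ (p : A → Bool) (f : A → ℕ) xs →
                  sum (map f (filterᵇ p xs)) ≡ sum (map (λ x → ind (p x) (f x)) xs)
sum-map-filterᵇ p f []       = refl
sum-map-filterᵇ p f (x ∷ xs) with p x
... | true  = cong (f x +_) (sum-map-filterᵇ p f xs)
... | false = sum-map-filterᵇ p f xs

sum-map-ind : ∀ b (f : A → ℕ) xs → sum (map (λ x → ind b (f x)) xs) ≡ ind b (sum (map f xs))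
sum-map-ind true  f xs = refl
sum-map-ind false f xs = sum-map-zero xs

product-map-* : ∀ (f g : A → ℕ) xs → product (map (λ x → f x * g x) xs) ≡ product (map f xs) * product (map g xs)
product-map-* f g []       = refl
product-map-* f g (x ∷ xs) = trans (cong (f x * g x *_) (product-map-* f g xs)) (interchange (f x) (g x) _ _)
  where
  interchange : ∀ a b c d → a * b * (c * d) ≡ a * c * (b * d)
  interchange = solve-∀

product-map-^ : ∀ m (e : A → ℕ) xs → product (map (λ x → m ^ e x) xs) ≡ m ^ sum (map e xs)
product-map-^ m e []       = refl
product-map-^ m e (x ∷ xs) = trans (cong (m ^ e x *_) (product-map-^ m e xs)) (sym (^-distribˡ-+-* m (e x) _))

sum-map-fibres : ∀ (o : A → ℕ) N (h : A → ℕ) xs → (∀ x → o x ≤ N) →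
  sum (map h xs) ≡ sum (map (λ s → sum (map (λ x → ind (o x ≡ᵇ s) (h x)) xs)) (upTo (suc N)))
sum-map-fibres o N h xs o≤N =
  sym (trans (sum-map-swap (λ x s → ind (o x ≡ᵇ s) (h x)) xs (upTo (suc N)))
             (sum-map-cong (λ x → sum-upTo-≡ᵇ N (o x) (h x) (o≤N x)) xs))
  where
  sum-upTo-≡ᵇ : ∀ N c y → c ≤ N → sum (map (λ s → ind (c ≡ᵇ s) y) (upTo (suc N))) ≡ y
  sum-upTo-≡ᵇ N       zero    y _ =
    trans (cong sum (map-upTo-suc (λ s → ind (0 ≡ᵇ s) y) N))
          (trans (cong (y +_) (sum-map-zero (upTo N))) (+-identityʳ y))
  sum-upTo-≡ᵇ (suc N) (suc c) y (s≤s c≤N) =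
    trans (cong sum (map-upTo-suc (λ s → ind (suc c ≡ᵇ s) y) (suc N))) (sum-upTo-≡ᵇ N c y c≤N)

countᵇ-none : ∀ L (c : ℕ → Bool) → (∀ i → i < L → c i ≡ false) → countᵇ (map c (upTo L)) ≡ 0
countᵇ-none zero    c off = refl
countᵇ-none (suc L) c off = trans (cong countᵇ (map-upTo-suc c L))
  (cong₂ (λ b n → bit b + n) (off 0 z<s) (countᵇ-none L (c ∘ suc) λ i i<L → off (suc i) (s<s i<L)))

countᵇ-unique : ∀ L a (c : ℕ → Bool) → a < L → c a ≡ true → (∀ i → i < L → c i ≡ true → i ≡ a) →
                countᵇ (map c (upTo L)) ≡ 1
countᵇ-unique (suc L) zero    c _         ca only = trans (cong countᵇ (map-upTo-suc c L))
  (cong₂ (λ b n → bit b + n) ca (countᵇ-none L (c ∘ suc) λ i i<L → ¬-not λ hit → 1+n≢0 (only (suc i) (s<s i<L) hit)))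
countᵇ-unique (suc L) (suc a) c (s<s a<L) ca only = trans (cong countᵇ (map-upTo-suc c L))
  (cong₂ (λ b n → bit b + n) (¬-not λ hit → 0≢1+n (only 0 z<s hit))
         (countᵇ-unique L a (c ∘ suc) a<L ca λ i i<L hit → suc-injective (only (suc i) (s<s i<L) hit)))

countᵇ-∧ : ∀ b (c : A → Bool) xs → countᵇ (map (λ x → b ∧ c x) xs) ≡ bit b * countᵇ (map c xs)
countᵇ-∧ true  c xs = sym (+-identityʳ _)
countᵇ-∧ false c xs = trans (sum-map-∘ bit _ xs) (sum-map-zero xs)

Σw : (n : ℕ) → (Vec Bool n → ℕ) → ℕ
Σw n f = sum (map f (words n))

Σw-suc : ∀ n (f : Vec Bool (suc n) → ℕ) → Σw (suc n) f ≡ Σw n (f ∘ (false ∷_)) + Σw n (f ∘ (true ∷_))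
Σw-suc n f = trans (sum-map-++ f (map (false ∷_) (words n)) (map (true ∷_) (words n)))
                   (cong₂ _+_ (sum-map-∘ f (false ∷_) (words n)) (sum-map-∘ f (true ∷_) (words n)))

Σw-++ : ∀ a b (f : Vec Bool (a + b) → ℕ) → Σw (a + b) f ≡ Σw a (λ u → Σw b (λ w → f (u ++ᵥ w)))
Σw-++ zero    b f = sym (+-identityʳ _)
Σw-++ (suc a) b f = begin
  Σw (suc a + b) f
    ≡⟨ Σw-suc (a + b) f ⟩
  Σw (a + b) (f ∘ (false ∷_)) + Σw (a + b) (f ∘ (true ∷_))
    ≡⟨ cong₂ _+_ (Σw-++ a b (f ∘ (false ∷_))) (Σw-++ a b (f ∘ (true ∷_))) ⟩
  Σw a (λ u → Σw b (λ w → f (false ∷ u ++ᵥ w))) + Σw a (λ u → Σw b (λ w → f (true ∷ u ++ᵥ w)))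
    ≡⟨ Σw-suc a (λ u → Σw b (λ w → f (u ++ᵥ w))) ⟨
  Σw (suc a) (λ u → Σw b (λ w → f (u ++ᵥ w)))
    ∎
  where open ≡-Reasoning

at-head : ∀ {n} b (v : Vec Bool n) → at (b ∷ v) 0 ≡ b
at-head {n} b v with 0 <? suc n
... | yes _   = refl
... | no  0≮ = ⊥-elim (0≮ z<s)

at-tail : ∀ {n} b (v : Vec Bool n) p → at (b ∷ v) (suc p) ≡ at v p
at-tail {n} b v p with suc p <? suc n | p <? n
... | yes _   | yes _   = refl
... | yes p<n | no  p≮n = ⊥-elim (p≮n (s<s⁻¹ p<n))
... | no  p≮n | yes p<n = ⊥-elim (p≮n (s<s p<n))
... | no  _   | no  _   = refl

at-++ˡ : ∀ {n m} (u : Vec Bool n) (w : Vec Bool m) p → p < n → at (u ++ᵥ w) p ≡ at u p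
at-++ˡ (b ∷ u) w zero    _         = trans (at-head b (u ++ᵥ w)) (sym (at-head b u))
at-++ˡ (b ∷ u) w (suc p) (s<s p<n) =
  trans (at-tail b (u ++ᵥ w) p) (trans (at-++ˡ u w p p<n) (sym (at-tail b u p)))

at-++ʳ : ∀ {n m} (u : Vec Bool n) (w : Vec Bool m) p → at (u ++ᵥ w) (n + p) ≡ at w p
at-++ʳ []      w p = refl
at-++ʳ (b ∷ u) w p = trans (at-tail b (u ++ᵥ w) _) (at-++ʳ u w p)

tally : (Bool → ℕ) → ∀ {n} → Vec Bool n → ℕ
tally h []      = 0
tally h (b ∷ v) = h b + tally h v

zeros : ∀ {n} → Vec Bool n → ℕ
zeros = tally (bit ∘ not)

ones≡tally : ∀ {n} (v : Vec Bool n) → ones v ≡ tally bit v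
ones≡tally []      = refl
ones≡tally (b ∷ v) = cong (bit b +_) (ones≡tally v)

sum-at : ∀ (h : Bool → ℕ) {n} (v : Vec Bool n) → sum (map (h ∘ at v) (upTo n)) ≡ tally h v
sum-at h []              = refl
sum-at h {suc n} (b ∷ v) = begin
  sum (map (h ∘ at (b ∷ v)) (upTo (suc n)))
    ≡⟨ cong sum (map-upTo-suc (h ∘ at (b ∷ v)) n) ⟩
  h (at (b ∷ v) 0) + sum (map (h ∘ at (b ∷ v) ∘ suc) (upTo n))
    ≡⟨ cong₂ _+_ (cong h (at-head b v)) (sum-map-cong (cong h ∘ at-tail b v) (upTo n)) ⟩
  h b + sum (map (h ∘ at v) (upTo n))
    ≡⟨ cong (h b +_) (sum-at h v) ⟩
  tally h (b ∷ v)
    ∎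
  where open ≡-Reasoning

tally-++ : ∀ h {n m} (u : Vec Bool n) (w : Vec Bool m) → tally h (u ++ᵥ w) ≡ tally h u + tally h w
tally-++ h []      w = refl
tally-++ h (b ∷ u) w = trans (cong (h b +_) (tally-++ h u w)) (sym (+-assoc (h b) _ _))

ones-++ : ∀ {n m} (u : Vec Bool n) (w : Vec Bool m) → ones (u ++ᵥ w) ≡ ones u + ones w
ones-++ u w = trans (ones≡tally (u ++ᵥ w))
  (trans (tally-++ bit u w) (sym (cong₂ _+_ (ones≡tally u) (ones≡tally w))))

zeros-++ : ∀ {n m} (u : Vec Bool n) (w : Vec Bool m) → zeros (u ++ᵥ w) ≡ zeros u + zeros w
zeros-++ = tally-++ (bit ∘ not)

ones≤length : ∀ {n} (v : Vec Bool n) → ones v ≤ n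
ones≤length []          = z≤n
ones≤length (false ∷ v) = m≤n⇒m≤1+n (ones≤length v)
ones≤length (true ∷ v)  = s≤s (ones≤length v)

ones+zeros : ∀ {n} (v : Vec Bool n) → ones v + zeros v ≡ n
ones+zeros []          = refl
ones+zeros (false ∷ v) = trans (+-suc (ones v) (zeros v)) (cong suc (ones+zeros v))
ones+zeros (true ∷ v)  = cong suc (ones+zeros v)

zeros≡∸ones : ∀ {n} (v : Vec Bool n) → zeros v ≡ n ∸ ones v
zeros≡∸ones v = trans (sym (m+n∸m≡n (ones v) (zeros v))) (cong (_∸ ones v) (ones+zeros v))

inversions : ∀ {n} → Vec Bool n → ℕ
inversions []      = 0
inversions (b ∷ v) = bit b * zeros v + inversions v

inv≡inversions : ∀ {n} (v : Vec Bool n) → inv v ≡ inversions v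
inv≡inversions []              = refl
inv≡inversions {suc n} (b ∷ v) = begin
  sum (map (row (b ∷ v)) (upTo (suc n)))
    ≡⟨ cong sum (map-upTo-suc (row (b ∷ v)) n) ⟩
  row (b ∷ v) 0 + sum (map (row (b ∷ v) ∘ suc) (upTo n))
    ≡⟨ cong₂ _+_ row-head (sum-map-cong row-tail (upTo n)) ⟩
  bit b * zeros v + inv v
    ≡⟨ cong (bit b * zeros v +_) (inv≡inversions v) ⟩
  inversions (b ∷ v)
    ∎
  where
  open ≡-Reasoning
  descent : ∀ {n} → Vec Bool n → ℕ → ℕ → Bool
  descent v i j = (i <ᵇ j) ∧ at v i ∧ not (at v j)

  row : ∀ {n} → Vec Bool n → ℕ → ℕ
  row {n} v i = countᵇ (map (descent v i) (upTo n))

  row-head : row (b ∷ v) 0 ≡ bit b * zeros v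
  row-head = begin
    countᵇ (map (descent (b ∷ v) 0) (upTo (suc n)))
      ≡⟨ cong countᵇ (map-upTo-suc (descent (b ∷ v) 0) n) ⟩
    countᵇ (map (λ j → at (b ∷ v) 0 ∧ not (at (b ∷ v) (suc j))) (upTo n))
      ≡⟨ cong countᵇ (map-cong (λ j → cong₂ (λ x y → x ∧ not y) (at-head b v) (at-tail b v j)) (upTo n)) ⟩
    countᵇ (map (λ j → b ∧ not (at v j)) (upTo n))
      ≡⟨ countᵇ-∧ b (not ∘ at v) (upTo n) ⟩
    bit b * countᵇ (map (not ∘ at v) (upTo n))
      ≡⟨ cong (bit b *_) (trans (sum-map-∘ bit (not ∘ at v) (upTo n)) (sum-at (bit ∘ not) v)) ⟩
    bit b * zeros v
      ∎

  row-tail : ∀ i → row (b ∷ v) (suc i) ≡ row v i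
  row-tail i = trans (cong countᵇ (map-upTo-suc (descent (b ∷ v) (suc i)) n))
    (cong countᵇ (map-cong (λ j → cong₂ (λ x y → (i <ᵇ j) ∧ x ∧ not y) (at-tail b v i) (at-tail b v j)) (upTo n)))

inversions-++ : ∀ {n m} (u : Vec Bool n) (w : Vec Bool m) →
                inversions (u ++ᵥ w) ≡ inversions u + ones u * zeros w + inversions w
inversions-++ []      w = refl
inversions-++ (b ∷ u) w = begin
  bit b * zeros (u ++ᵥ w) + inversions (u ++ᵥ w)
    ≡⟨ cong₂ (λ z i → bit b * z + i) (zeros-++ u w) (inversions-++ u w) ⟩
  bit b * (zeros u + zeros w) + (inversions u + ones u * zeros w + inversions w)
    ≡⟨ regroup (bit b) (zeros u) (zeros w) (inversions u) (ones u) (inversions w) ⟩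
  bit b * zeros u + inversions u + (bit b + ones u) * zeros w + inversions w
    ∎
  where
  open ≡-Reasoning
  regroup : ∀ b zu zw iu ou iw → b * (zu + zw) + (iu + ou * zw + iw) ≡ b * zu + iu + (b + ou) * zw + iw
  regroup = solve-∀

q^inversions-++ : ∀ q {n m} (u : Vec Bool n) (w : Vec Bool m) →
                  q ^ inversions (u ++ᵥ w) ≡ q ^ inversions u * q ^ (ones u * zeros w) * q ^ inversions w
q^inversions-++ q u w = begin
  q ^ inversions (u ++ᵥ w)                                      ≡⟨ cong (q ^_) (inversions-++ u w) ⟩
  q ^ (inversions u + ones u * zeros w + inversions w)          ≡⟨ ^-distribˡ-+-* q (inversions u + ones u * zeros w) (inversions w) ⟩
  q ^ (inversions u + ones u * zeros w) * q ^ inversions w      ≡⟨ cong (_* q ^ inversions w) (^-distribˡ-+-* q (inversions u) _) ⟩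
  q ^ inversions u * q ^ (ones u * zeros w) * q ^ inversions w  ∎
  where open ≡-Reasoning

-- The Gaussian coefficient as an inversion generating function

module _ (q : ℕ) where

  qint-suc : ∀ m → qint (suc m) q ≡ 1 + q * qint m q
  qint-suc m = cong (1 +_) (begin
    sum (map (q ^_) (applyUpTo suc m))   ≡⟨ cong sum (map-applyUpTo suc (q ^_) m) ⟩
    sum (applyUpTo (λ i → q ^ suc i) m)  ≡⟨ cong sum (map-upTo (λ i → q * q ^ i) m) ⟨
    sum (map (λ i → q * q ^ i) (upTo m)) ≡⟨ sum-map-*ˡ q (q ^_) (upTo m) ⟩
    q * qint m q                          ∎)
    where open ≡-Reasoning

  qint-+ : ∀ a b → qint (a + b) q ≡ qint a q + q ^ a * qint b q
  qint-+ zero    b = sym (+-identityʳ (qint b q))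
  qint-+ (suc a) b = begin
    qint (suc (a + b)) q                       ≡⟨ qint-suc (a + b) ⟩
    1 + q * qint (a + b) q                     ≡⟨ cong (λ x → 1 + q * x) (qint-+ a b) ⟩
    1 + q * (qint a q + q ^ a * qint b q)      ≡⟨ distrib q (qint a q) (q ^ a) (qint b q) ⟩
    (1 + q * qint a q) + q * q ^ a * qint b q  ≡⟨ cong (_+ q ^ suc a * qint b q) (qint-suc a) ⟨
    qint (suc a) q + q ^ suc a * qint b q      ∎
    where
    open ≡-Reasoning
    distrib : ∀ q x p y → 1 + q * (x + p * y) ≡ 1 + q * x + q * p * y
    distrib = solve-∀

  qfact-suc : ∀ m → qfact (suc m) q ≡ qfact m q * qint (suc m) q
  qfact-suc m = begin
    product (map factor (upTo (suc m)))          ≡⟨ cong (product ∘ map factor) (upTo-∷ʳ m) ⟨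
    product (map factor (upTo m ++ [ m ]))       ≡⟨ cong product (map-++ factor (upTo m) [ m ]) ⟩
    product (map factor (upTo m) ++ [ factor m ]) ≡⟨ product-++ (map factor (upTo m)) [ factor m ] ⟩
    qfact m q * (factor m * 1)                   ≡⟨ cong (qfact m q *_) (*-identityʳ (factor m)) ⟩
    qfact m q * qint (suc m) q                   ∎
    where
    open ≡-Reasoning
    factor : ℕ → ℕ
    factor i = qint (suc i) q

  qfact-positive : ∀ m → 1 ≤ qfact m q
  qfact-positive zero    = ≤-refl
  qfact-positive (suc m) = subst (1 ≤_) (sym (qfact-suc m)) (*-mono-≤ (qfact-positive m) (s≤s z≤n))

  invSum : ℕ → ℕ → ℕ
  invSum n k = Σw n (λ u → ind (ones u ≡ᵇ k) (q ^ inversions u))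

  invSum-zero : ∀ n → invSum n 0 ≡ 1
  invSum-zero zero    = refl
  invSum-zero (suc n) = trans (Σw-suc n _) (cong₂ _+_ (invSum-zero n) (sum-map-zero (words n)))

  invSum-> : ∀ {n k} → n < k → invSum n k ≡ 0
  invSum-> {n} {k} n<k = trans (sum-map-cong vanishes (words n)) (sum-map-zero (words n))
    where
    vanishes : ∀ u → ind (ones u ≡ᵇ k) (q ^ inversions u) ≡ 0
    vanishes u rewrite ≢⇒≡ᵇ≡false (λ eq → <⇒≱ n<k (subst (_≤ n) eq (ones≤length u))) = refl

  invSum-suc : ∀ n k → invSum (suc n) (suc k) ≡ invSum n (suc k) + q ^ (n ∸ k) * invSum n k
  invSum-suc n k = trans (Σw-suc n _)
    (cong (invSum n (suc k) +_) (trans (sum-map-cong leading-one (words n)) (sum-map-*ˡ (q ^ (n ∸ k)) _ (words n))))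
    where
    leading-one : ∀ u → ind (ones u ≡ᵇ k) (q ^ (1 * zeros u + inversions u))
                      ≡ q ^ (n ∸ k) * ind (ones u ≡ᵇ k) (q ^ inversions u)
    leading-one u with ones u ≡ᵇ k in eq
    ... | false = sym (*-zeroʳ (q ^ (n ∸ k)))
    ... | true  = begin
      q ^ (1 * zeros u + inversions u)   ≡⟨ cong (λ z → q ^ (z + inversions u)) (*-identityˡ (zeros u)) ⟩
      q ^ (zeros u + inversions u)       ≡⟨ ^-distribˡ-+-* q (zeros u) (inversions u) ⟩
      q ^ zeros u * q ^ inversions u     ≡⟨ cong (λ z → q ^ z * q ^ inversions u) (zeros≡∸ones u) ⟩
      q ^ (n ∸ ones u) * q ^ inversions u ≡⟨ cong (λ o → q ^ (n ∸ o) * q ^ inversions u) (≡ᵇ≡true⇒≡ {ones u} eq) ⟩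
      q ^ (n ∸ k) * q ^ inversions u      ∎
      where open ≡-Reasoning

  invSum-diag : ∀ n → invSum n n ≡ 1
  invSum-diag zero    = refl
  invSum-diag (suc n) = begin
    invSum (suc n) (suc n)                      ≡⟨ invSum-suc n n ⟩
    invSum n (suc n) + q ^ (n ∸ n) * invSum n n ≡⟨ cong₂ (λ a e → a + q ^ e * invSum n n) (invSum-> (n<1+n n)) (n∸n≡0 n) ⟩
    invSum n n + 0                              ≡⟨ +-identityʳ (invSum n n) ⟩
    invSum n n                                  ≡⟨ invSum-diag n ⟩
    1                                           ∎
    where open ≡-Reasoning

  invSum-qfact : ∀ k d → invSum (k + d) k * (qfact k q * qfact d q) ≡ qfact (k + d) q
  invSum-qfact zero d =
    trans (cong (_* (1 * qfact d q)) (invSum-zero d)) (trans (*-identityˡ _) (*-identityˡ _))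
  invSum-qfact (suc k) zero rewrite +-identityʳ k | invSum-diag (suc k) =
    trans (*-identityˡ _) (*-identityʳ _)
  invSum-qfact (suc k) (suc d) = begin
    invSum (suc N) (suc k) * (qfact (suc k) q * qfact (suc d) q)
      ≡⟨ cong₂ _*_ (invSum-suc N k) (cong₂ _*_ (qfact-suc k) (qfact-suc d)) ⟩
    (invSum N (suc k) + q ^ (N ∸ k) * invSum N k) * (f k * I (suc k) * (f d * I (suc d)))
      ≡⟨ cong₂ (λ x e → (x + q ^ e * invSum N k) * (f k * I (suc k) * (f d * I (suc d))))
               (cong (λ m → invSum m (suc k)) (+-suc k d)) (m+n∸m≡n k (suc d)) ⟩
    (invSum (suc k + d) (suc k) + q ^ suc d * invSum N k) * (f k * I (suc k) * (f d * I (suc d)))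
      ≡⟨ expand (invSum (suc k + d) (suc k)) (invSum N k) (q ^ suc d) (f k) (f d) (I (suc k)) (I (suc d)) ⟩
    invSum (suc k + d) (suc k) * (f k * I (suc k) * f d) * I (suc d) + invSum N k * (f k * (f d * I (suc d))) * (q ^ suc d * I (suc k))
      ≡⟨ cong₂ (λ x y → x * I (suc d) + y * (q ^ suc d * I (suc k)))
               (trans (cong (λ x → invSum (suc k + d) (suc k) * (x * f d)) (sym (qfact-suc k))) (invSum-qfact (suc k) d))
               (trans (cong (λ x → invSum N k * (f k * x)) (sym (qfact-suc d))) (invSum-qfact k (suc d))) ⟩
    f (suc k + d) * I (suc d) + f N * (q ^ suc d * I (suc k))
      ≡⟨ cong (λ m → f m * I (suc d) + f N * (q ^ suc d * I (suc k))) (sym (+-suc k d)) ⟩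
    f N * I (suc d) + f N * (q ^ suc d * I (suc k))
      ≡⟨ *-distribˡ-+ (f N) (I (suc d)) (q ^ suc d * I (suc k)) ⟨
    f N * (I (suc d) + q ^ suc d * I (suc k))
      ≡⟨ cong (f N *_) (qint-+ (suc d) (suc k)) ⟨
    f N * I (suc d + suc k)
      ≡⟨ cong (λ m → f N * I m) (+-comm (suc d) (suc k)) ⟩
    f N * I (suc N)
      ≡⟨ qfact-suc N ⟨
    f (suc N)
      ∎
    where
    open ≡-Reasoning
    N = k + suc d
    f I : ℕ → ℕ
    f m = qfact m q
    I m = qint m q
    expand : ∀ A B Q fk fd Ik Id →
      (A + Q * B) * (fk * Ik * (fd * Id)) ≡ A * (fk * Ik * fd) * Id + B * (fk * (fd * Id)) * (Q * Ik)
    expand = solve-∀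

  gauss≡invSum : ∀ {n k} → k ≤ n → gauss n k q ≡ invSum n k
  gauss≡invSum {n} {k} k≤n = subst (λ n → gauss n k q ≡ invSum n k) (m+[n∸m]≡n k≤n) (split k (n ∸ k))
    where
    divℕ-*-cancel : ∀ a b → 1 ≤ b → divℕ (a * b) b ≡ a
    divℕ-*-cancel a (suc b) _ = m*n/n≡m a (suc b)

    split : ∀ k d → gauss (k + d) k q ≡ invSum (k + d) k
    split k d = begin
      divℕ (qfact (k + d) q) (qfact k q * qfact (k + d ∸ k) q)
        ≡⟨ cong (λ e → divℕ (qfact (k + d) q) (qfact k q * qfact e q)) (m+n∸m≡n k d) ⟩
      divℕ (qfact (k + d) q) (qfact k q * qfact d q)
        ≡⟨ cong (λ x → divℕ x (qfact k q * qfact d q)) (invSum-qfact k d) ⟨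
      divℕ (invSum (k + d) k * (qfact k q * qfact d q)) (qfact k q * qfact d q)
        ≡⟨ divℕ-*-cancel (invSum (k + d) k) _ (*-mono-≤ (qfact-positive k) (qfact-positive d)) ⟩
      invSum (k + d) k
        ∎
      where open ≡-Reasoning

  gauss-sym : ∀ {n k} → k ≤ n → gauss n (n ∸ k) q ≡ gauss n k q
  gauss-sym {n} {k} k≤n = cong (divℕ (qfact n q))
    (trans (cong (λ e → qfact (n ∸ k) q * qfact e q) (m∸[m∸n]≡n k≤n)) (*-comm (qfact (n ∸ k) q) (qfact k q)))

  Σw-by-ones : ∀ n (H : ℕ → ℕ → ℕ) →
    Σw n (λ u → q ^ inversions u * H (ones u) (zeros u)) ≡ sum (map (λ s → invSum n s * H s (n ∸ s)) (upTo (suc n)))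
  Σw-by-ones n H = trans (sum-map-fibres ones n _ (words n) ones≤length) (sum-map-cong fibre (upTo (suc n)))
    where
    restrict : ∀ s u → ind (ones u ≡ᵇ s) (q ^ inversions u * H (ones u) (zeros u))
                     ≡ H s (n ∸ s) * ind (ones u ≡ᵇ s) (q ^ inversions u)
    restrict s u with ones u ≡ᵇ s in eq
    ... | false = sym (*-zeroʳ (H s (n ∸ s)))
    ... | true rewrite zeros≡∸ones u | ≡ᵇ≡true⇒≡ {ones u} eq = *-comm (q ^ inversions u) (H s (n ∸ s))

    fibre : ∀ s → Σw n (λ u → ind (ones u ≡ᵇ s) (q ^ inversions u * H (ones u) (zeros u))) ≡ invSum n s * H s (n ∸ s)
    fibre s = trans (sum-map-cong (restrict s) (words n))
                    (trans (sum-map-*ˡ (H s (n ∸ s)) _ (words n)) (*-comm (H s (n ∸ s)) (invSum n s)))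

allTrue : ∀ {n} → Vec Bool n → Bool
allTrue []      = true
allTrue (b ∷ v) = b ∧ allTrue v

sorted : ∀ {n} → Vec Bool n → Bool
sorted []          = true
sorted (false ∷ v) = sorted v
sorted (true ∷ v)  = allTrue v

sorted≡adjacent : ∀ {n} (u : Vec Bool n) →
                  allᵇ (map (λ t → leB (at u t) (at u (suc t))) (upTo (n ∸ 1))) ≡ sorted u
sorted≡adjacent []              = refl
sorted≡adjacent (false ∷ [])    = refl
sorted≡adjacent (true ∷ [])     = refl
sorted≡adjacent {suc (suc n)} (b ∷ c ∷ u) = begin
  allᵇ (map (adjacent (b ∷ c ∷ u)) (upTo (suc n)))
    ≡⟨ cong allᵇ (map-upTo-suc (adjacent (b ∷ c ∷ u)) n) ⟩
  adjacent (b ∷ c ∷ u) 0 ∧ allᵇ (map (adjacent (b ∷ c ∷ u) ∘ suc) (upTo n))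
    ≡⟨ cong₂ _∧_ (cong₂ leB (at-head b (c ∷ u)) (trans (at-tail b (c ∷ u) 0) (at-head c u)))
                 (cong allᵇ (map-cong (λ t → cong₂ leB (at-tail b (c ∷ u) t) (at-tail b (c ∷ u) (suc t))) (upTo n))) ⟩
  leB b c ∧ allᵇ (map (adjacent (c ∷ u)) (upTo n))
    ≡⟨ cong (leB b c ∧_) (sorted≡adjacent (c ∷ u)) ⟩
  leB b c ∧ sorted (c ∷ u)
    ≡⟨ sorted-∷∷ b c ⟩
  sorted (b ∷ c ∷ u)
    ∎
  where
  open ≡-Reasoning
  adjacent : ∀ {n} → Vec Bool n → ℕ → Bool
  adjacent v t = leB (at v t) (at v (suc t))

  sorted-∷∷ : ∀ b c → leB b c ∧ sorted (c ∷ u) ≡ sorted (b ∷ c ∷ u)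
  sorted-∷∷ false c     = refl
  sorted-∷∷ true  false = refl
  sorted-∷∷ true  true  = refl

allTrue⇒sorted : ∀ {n} (u : Vec Bool n) → T (allTrue u) → T (sorted u)
allTrue⇒sorted []         _ = tt
allTrue⇒sorted (true ∷ u) t = t

allTrue⇒zeros≡0 : ∀ {n} (u : Vec Bool n) → T (allTrue u) → zeros u ≡ 0
allTrue⇒zeros≡0 []         _ = refl
allTrue⇒zeros≡0 (true ∷ u) t = allTrue⇒zeros≡0 u t

sorted⇒inversions≡0 : ∀ {n} (u : Vec Bool n) → T (sorted u) → inversions u ≡ 0
sorted⇒inversions≡0 []          _ = refl
sorted⇒inversions≡0 (false ∷ u) t = sorted⇒inversions≡0 u t
sorted⇒inversions≡0 (true ∷ u)  t =
  cong₂ (λ z i → 1 * z + i) (allTrue⇒zeros≡0 u t) (sorted⇒inversions≡0 u (allTrue⇒sorted u t))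

Σw-allTrue : ∀ n (H : ℕ → ℕ) → Σw n (λ u → ind (allTrue u) (H (ones u))) ≡ H n
Σw-allTrue zero    H = +-identityʳ (H 0)
Σw-allTrue (suc n) H = trans (Σw-suc n _) (cong₂ _+_ (sum-map-zero (words n)) (Σw-allTrue n (H ∘ suc)))

Σw-sorted : ∀ n (H : ℕ → ℕ) → Σw n (λ u → ind (sorted u) (H (ones u))) ≡ sum (map H (upTo (suc n)))
Σw-sorted zero    H = refl
Σw-sorted (suc n) H = begin
  Σw (suc n) (λ u → ind (sorted u) (H (ones u)))
    ≡⟨ Σw-suc n _ ⟩
  Σw n (λ u → ind (sorted u) (H (ones u))) + Σw n (λ u → ind (allTrue u) (H (suc (ones u))))
    ≡⟨ cong₂ _+_ (Σw-sorted n H) (trans (Σw-allTrue n (H ∘ suc)) (sym (+-identityʳ _))) ⟩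
  sum (map H (upTo (suc n))) + sum (map H [ suc n ])
    ≡⟨ sum-map-++ H (upTo (suc n)) [ suc n ] ⟨
  sum (map H (upTo (suc n) ++ [ suc n ]))
    ≡⟨ cong (sum ∘ map H) (upTo-∷ʳ (suc n)) ⟩
  sum (map H (upTo (suc (suc n))))
    ∎
  where open ≡-Reasoning

-- Cutting a word into blocks of length r

<∸1⇒suc< : ∀ {t} r → t < r ∸ 1 → suc t < r
<∸1⇒suc< (suc r) t<r = s<s t<r

module _ (r : ℕ) where

  blockwise : ((ℕ → Bool) → A) → ∀ {n} → Vec Bool n → List A
  blockwise P {n} v = map (λ j → P (λ t → at v (r * j + t))) (upTo (divℕ n r))

  ReadsBelow : ((ℕ → Bool) → A) → Set
  ReadsBelow P = ∀ {f g} → (∀ t → t < r → f t ≡ g t) → P f ≡ P g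

  blockwise-short : ∀ (P : (ℕ → Bool) → A) {n} (v : Vec Bool n) → n < r → blockwise P v ≡ []
  blockwise-short P {n} v n<r = cong (λ d → map (λ j → P (λ t → at v (r * j + t))) (upTo d)) (divℕ-< r n<r)
    where
    divℕ-< : ∀ r → n < r → divℕ n r ≡ 0
    divℕ-< (suc r) n<r = m<n⇒m/n≡0 n<r

  blockwise-++ : 1 ≤ r → (P : (ℕ → Bool) → A) → ReadsBelow P →
                 ∀ {m} (u : Vec Bool r) (w : Vec Bool m) → blockwise P (u ++ᵥ w) ≡ P (at u) ∷ blockwise P w
  blockwise-++ 1≤r P local {m} u w = begin
    map block (upTo (divℕ (r + m) r))       ≡⟨ cong (map block ∘ upTo) (divℕ-+ r 1≤r) ⟩
    map block (upTo (suc (divℕ m r)))       ≡⟨ map-upTo-suc block (divℕ m r) ⟩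
    block 0 ∷ map (block ∘ suc) (upTo (divℕ m r))
      ≡⟨ cong₂ _∷_ (local (λ t t<r → trans (cong (λ p → at (u ++ᵥ w) (p + t)) (*-zeroʳ r)) (at-++ˡ u w t t<r)))
                   (map-cong (λ j → local (λ t _ → shift j t)) (upTo (divℕ m r))) ⟩
    P (at u) ∷ blockwise P w                 ∎
    where
    open ≡-Reasoning
    block : ℕ → _
    block j = P (λ t → at (u ++ᵥ w) (r * j + t))

    divℕ-+ : ∀ r → 1 ≤ r → divℕ (r + m) r ≡ suc (divℕ m r)
    divℕ-+ (suc r) _ = trans (m/n≡1+[m∸n]/n (m≤m+n (suc r) m)) (cong (λ x → suc (x / suc r)) (m+n∸m≡n (suc r) m))

    shift : ∀ j t → at (u ++ᵥ w) (r * suc j + t) ≡ at w (r * j + t)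
    shift j t = trans (cong (at (u ++ᵥ w)) (trans (cong (_+ t) (*-suc r j)) (+-assoc r (r * j) t)))
                      (at-++ʳ u w (r * j + t))

  sortedBlock : (ℕ → Bool) → Bool
  sortedBlock f = allᵇ (map (λ t → leB (f t) (f (suc t))) (upTo (r ∸ 1)))

  blockOnes : (ℕ → Bool) → ℕ
  blockOnes f = sum (map (λ t → bit (f t)) (upTo r))

  inPair : ℕ → ℕ → Bool
  inPair i s = (s ≡ᵇ i) ∨ (s ≡ᵇ (r ∸ i))

  -- The block condition of inOmega is definitionally allᵇ (blockwise sortedBlock v), and bstat r i v
  -- is definitionally countᵇ (blockwise (inPair i ∘ blockOnes) v).
  blockSorted : ∀ {n} → Vec Bool n → Bool
  blockSorted v = allᵇ (blockwise sortedBlock v)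

  blockSorted-++ : 1 ≤ r → ∀ {m} (u : Vec Bool r) (w : Vec Bool m) → blockSorted (u ++ᵥ w) ≡ sorted u ∧ blockSorted w
  blockSorted-++ 1≤r u w = trans (cong allᵇ (blockwise-++ 1≤r sortedBlock local u w))
                                 (cong (_∧ blockSorted w) (sorted≡adjacent u))
    where
    local : ReadsBelow sortedBlock
    local eq = cong allᵇ (map-upTo-cong (r ∸ 1) λ t t<r∸1 →
      cong₂ leB (eq t (<-trans (n<1+n t) (<∸1⇒suc< r t<r∸1))) (eq (suc t) (<∸1⇒suc< r t<r∸1)))

  bstat-++ : 1 ≤ r → ∀ i {m} (u : Vec Bool r) (w : Vec Bool m) →
             bstat r i (u ++ᵥ w) ≡ bit (inPair i (ones u)) + bstat r i w
  bstat-++ 1≤r i u w =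
    trans (cong countᵇ (blockwise-++ 1≤r (inPair i ∘ blockOnes) local u w))
          (cong (λ s → bit (inPair i s) + bstat r i w) (trans (sum-at bit u) (sym (ones≡tally u))))
    where
    local : ReadsBelow (inPair i ∘ blockOnes)
    local eq = cong (inPair i ∘ sum) (map-upTo-cong r λ t t<r → cong bit (eq t t<r))

  blockSorted-short : ∀ {n} (v : Vec Bool n) → n < r → blockSorted v ≡ true
  blockSorted-short v n<r = cong allᵇ (blockwise-short sortedBlock v n<r)

  bstat-short : ∀ i {n} (v : Vec Bool n) → n < r → bstat r i v ≡ 0
  bstat-short i v n<r = cong countᵇ (blockwise-short (inPair i ∘ blockOnes) v n<r)

  -- The pairs {i, r - i} with 1 ≤ i ≤ ⌊r/2⌋

  private
    L : ℕ
    L = r / 2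

  L≤r : L ≤ r
  L≤r = m/n≤m r 2

  r≡r%2+L+L : r ≡ r % 2 + (L + L)
  r≡r%2+L+L = trans (m≡m%n+[m/n]*n r 2) (cong (r % 2 +_) (double L))
    where
    double : ∀ x → x * 2 ≡ x + x
    double = solve-∀

  L+L≤r : L + L ≤ r
  L+L≤r = ≤-trans (m≤n+m (L + L) (r % 2)) (≤-reflexive (sym r≡r%2+L+L))

  r≤1+L+L : r ≤ suc (L + L)
  r≤1+L+L = ≤-trans (≤-reflexive r≡r%2+L+L) (+-monoˡ-≤ (L + L) (s≤s⁻¹ (m%n<n r 2)))

  inPair-true : ∀ {j s} → j ≤ r → inPair j s ≡ true → s ≡ j ⊎ s + j ≡ r
  inPair-true {j} {s} j≤r hit with s ≡ᵇ j in e₁ | s ≡ᵇ (r ∸ j) in e₂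
  ... | true  | _    = inj₁ (≡ᵇ≡true⇒≡ {s} e₁)
  ... | false | true = inj₂ (trans (cong (_+ j) (≡ᵇ≡true⇒≡ {s} e₂)) (m∸n+n≡m j≤r))

  inPair-complement : ∀ {j s} → s + j ≡ r → inPair j s ≡ true
  inPair-complement {j} {s} s+j≡r =
    trans (cong ((s ≡ᵇ j) ∨_) (≡⇒≡ᵇ≡true (sym (trans (cong (_∸ j) (sym s+j≡r)) (m+n∸n≡m s j))))) (∨-zeroʳ _)

  -- The unique index is i = min (s, r - s), shifted by one since i ranges over 1, …, ⌊r/2⌋.
  inPair-count : ∀ {s} → 0 < s → s < r → countᵇ (map (λ i → inPair (suc i) s) (upTo L)) ≡ 1
  inPair-count {suc a} _ s<r with suc a ≤? L
  ... | yes s≤L = countᵇ-unique L a (λ i → inPair (suc i) (suc a)) s≤L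
                    (cong (_∨ (suc a ≡ᵇ r ∸ suc a)) (≡⇒≡ᵇ≡true {suc a} refl)) unique
    where
    squeeze : ∀ {x y} → x ≤ L → y ≤ L → x + y ≡ r → x ≡ L
    squeeze {x} x≤L y≤L x+y≡r = ≤-antisym x≤L
      (+-cancelʳ-≤ L L x (≤-trans L+L≤r (≤-trans (≤-reflexive (sym x+y≡r)) (+-monoʳ-≤ x y≤L))))

    unique : ∀ i → i < L → inPair (suc i) (suc a) ≡ true → i ≡ a
    unique i i<L hit with inPair-true (≤-trans i<L L≤r) hit
    ... | inj₁ e = suc-injective (sym e)
    ... | inj₂ e = suc-injective (trans (squeeze i<L s≤L (trans (+-comm (suc i) (suc a)) e))
                                        (sym (squeeze s≤L i<L e)))
  ... | no s≰L = countᵇ-unique L b (λ i → inPair (suc i) (suc a)) b<L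
                   (inPair-complement {suc b} {suc a} (trans (+-comm (suc a) (suc b)) complement)) unique
    where
    b = r ∸ suc (suc a)

    complement : suc b + suc a ≡ r
    complement = trans (sym (+-suc b (suc a))) (m∸n+n≡m s<r)

    b<L : b < L
    b<L = +-cancelʳ-≤ (suc L) (suc b) L (begin
      suc b + suc L   ≤⟨ +-monoʳ-≤ (suc b) (≰⇒> s≰L) ⟩
      suc b + suc a   ≡⟨ complement ⟩
      r               ≤⟨ r≤1+L+L ⟩
      suc (L + L)     ≡⟨ +-suc L L ⟨
      L + suc L       ∎)
      where open ≤-Reasoning

    unique : ∀ i → i < L → inPair (suc i) (suc a) ≡ true → i ≡ b
    unique i i<L hit with inPair-true (≤-trans i<L L≤r) hit
    ... | inj₁ e = ⊥-elim (s≰L (subst (_≤ L) (sym e) i<L))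
    ... | inj₂ e = suc-injective (+-cancelˡ-≡ (suc a) (suc i) (suc b)
                     (trans e (sym (trans (+-comm (suc a) (suc b)) complement))))

  blockProduct : ℕ → ∀ {n} → Vec Bool n → ℕ
  blockProduct q v = product (map (λ i → gauss r (suc i) q ^ bstat r (suc i) v) (upTo L))

  blockWeight : ℕ → ℕ → ℕ
  blockWeight q s = product (map (λ i → gauss r (suc i) q ^ bit (inPair (suc i) s)) (upTo L))

  blockProduct-++ : 1 ≤ r → ∀ q {m} (u : Vec Bool r) (w : Vec Bool m) →
                    blockProduct q (u ++ᵥ w) ≡ blockWeight q (ones u) * blockProduct q w
  blockProduct-++ 1≤r q u w = trans (cong product (map-cong split (upTo L))) (product-map-* _ _ (upTo L))
    where
    split : ∀ i → gauss r (suc i) q ^ bstat r (suc i) (u ++ᵥ w)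
                ≡ gauss r (suc i) q ^ bit (inPair (suc i) (ones u)) * gauss r (suc i) q ^ bstat r (suc i) w
    split i = trans (cong (gauss r (suc i) q ^_) (bstat-++ 1≤r (suc i) u w))
                    (^-distribˡ-+-* (gauss r (suc i) q) (bit (inPair (suc i) (ones u))) (bstat r (suc i) w))

  blockProduct-short : ∀ q {n} (v : Vec Bool n) → n < r → blockProduct q v ≡ 1
  blockProduct-short q v n<r =
    trans (cong product (map-cong (λ i → cong (gauss r (suc i) q ^_) (bstat-short (suc i) v n<r)) (upTo L)))
          (product-map-one (upTo L))
    where
    product-map-one : ∀ (xs : List ℕ) → product (map (λ _ → 1) xs) ≡ 1
    product-map-one []       = refl
    product-map-one (x ∷ xs) = trans (+-identityʳ _) (product-map-one xs)

  blockWeight≡gauss : ∀ q {s} → s ≤ r → blockWeight q s ≡ gauss r s q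
  blockWeight≡gauss q {s} s≤r = begin
    blockWeight q s
      ≡⟨ cong product (map-upTo-cong L same-base) ⟩
    product (map (λ i → gauss r s q ^ bit (inPair (suc i) s)) (upTo L))
      ≡⟨ product-map-^ (gauss r s q) (λ i → bit (inPair (suc i) s)) (upTo L) ⟩
    gauss r s q ^ sum (map (λ i → bit (inPair (suc i) s)) (upTo L))
      ≡⟨ cong (gauss r s q ^_) (sum-map-∘ bit (λ i → inPair (suc i) s) (upTo L)) ⟨
    gauss r s q ^ count s
      ≡⟨ collapse s s≤r ⟩
    gauss r s q
      ∎
    where
    open ≡-Reasoning
    same-base : ∀ i → i < L → gauss r (suc i) q ^ bit (inPair (suc i) s) ≡ gauss r s q ^ bit (inPair (suc i) s)
    same-base i i<L with inPair (suc i) s in hit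
    ... | false = refl
    ... | true with inPair-true (≤-trans i<L L≤r) hit
    ...   | inj₁ e = cong (λ k → gauss r k q ^ 1) (sym e)
    ...   | inj₂ e = cong (_^ 1) (trans (cong (λ k → gauss r k q) (sym (trans (cong (_∸ s) (sym e)) (m+n∸m≡n s (suc i)))))
                                       (gauss-sym q s≤r))

    gauss-edge : ∀ s → s ≡ 0 ⊎ s ≡ r → gauss r s q ≡ 1
    gauss-edge _ (inj₁ refl) = trans (gauss≡invSum q {r} z≤n) (invSum-zero q r)
    gauss-edge _ (inj₂ refl) = trans (gauss≡invSum q {r} ≤-refl) (invSum-diag q r)

    ^-of-one : ∀ x c → x ≡ 1 → x ^ c ≡ x
    ^-of-one _ c refl = ^-zeroˡ c

    count : ℕ → ℕ
    count s = countᵇ (map (λ i → inPair (suc i) s) (upTo L))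

    collapse : ∀ s → s ≤ r → gauss r s q ^ count s ≡ gauss r s q
    collapse zero    _   = ^-of-one (gauss r 0 q) (count 0) (gauss-edge 0 (inj₁ refl))
    collapse (suc a) s≤r with m≤n⇒m<n∨m≡n s≤r
    ... | inj₁ s<r rewrite inPair-count z<s s<r = *-identityʳ _
    ... | inj₂ s≡r = ^-of-one (gauss r (suc a) q) (count (suc a)) (gauss-edge (suc a) (inj₂ s≡r))

-- Collapsing every block to its sorted representative

module _ (r q : ℕ) (1≤r : 1 ≤ r) where

  collapseBlock : ∀ (K : ℕ → ℕ → ℕ) →
    Σw r (λ u → ind (sorted u) (blockWeight r q (ones u) * (q ^ inversions u * K (ones u) (zeros u))))
      ≡ Σw r (λ u → q ^ inversions u * K (ones u) (zeros u))
  collapseBlock K = begin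
    Σw r (λ u → ind (sorted u) (blockWeight r q (ones u) * (q ^ inversions u * K (ones u) (zeros u))))
      ≡⟨ sum-map-cong sorted-term (words r) ⟩
    Σw r (λ u → ind (sorted u) (H (ones u)))
      ≡⟨ Σw-sorted r H ⟩
    sum (map H (upTo (suc r)))
      ≡⟨ cong sum (map-upTo-cong (suc r) λ s s<1+r → cong (_* K s (r ∸ s)) (weight≡invSum (s≤s⁻¹ s<1+r))) ⟩
    sum (map (λ s → invSum q r s * K s (r ∸ s)) (upTo (suc r)))
      ≡⟨ Σw-by-ones q r K ⟨
    Σw r (λ u → q ^ inversions u * K (ones u) (zeros u))
      ∎
    where
    open ≡-Reasoning
    H : ℕ → ℕ
    H s = blockWeight r q s * K s (r ∸ s)

    sorted-term : ∀ u → ind (sorted u) (blockWeight r q (ones u) * (q ^ inversions u * K (ones u) (zeros u)))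
                      ≡ ind (sorted u) (H (ones u))
    sorted-term u with sorted u in eq
    ... | false = refl
    ... | true rewrite sorted⇒inversions≡0 u (subst T (sym eq) tt) | zeros≡∸ones u =
          cong (blockWeight r q (ones u) *_) (*-identityˡ _)

    weight≡invSum : ∀ {s} → s ≤ r → blockWeight r q s ≡ invSum q r s
    weight≡invSum s≤r = trans (blockWeight≡gauss r q s≤r) (gauss≡invSum q s≤r)

  -- Since F sees only letter counts, the cross term ones(u)·zeros(w) of a first block u can be
  -- pushed into the F of the tail w (see shifted below).
  BlockCollapse : ℕ → Set
  BlockCollapse n = ∀ (F : ℕ → ℕ → ℕ) →
    Σw n (λ v → ind (blockSorted r v) (q ^ inversions v * blockProduct r q v * F (ones v) (zeros v)))
      ≡ Σw n (λ v → q ^ inversions v * F (ones v) (zeros v))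

  blockCollapse-short : ∀ {n} → n < r → BlockCollapse n
  blockCollapse-short {n} n<r F = sum-map-cong no-blocks (words n)
    where
    no-blocks : ∀ v → ind (blockSorted r v) (q ^ inversions v * blockProduct r q v * F (ones v) (zeros v))
                    ≡ q ^ inversions v * F (ones v) (zeros v)
    no-blocks v rewrite blockSorted-short r v n<r | blockProduct-short r q v n<r =
      cong (_* F (ones v) (zeros v)) (*-identityʳ (q ^ inversions v))

  blockCollapse-step : ∀ {m} → BlockCollapse m → BlockCollapse (r + m)
  blockCollapse-step {m} IH F = begin
    Σw (r + m) (λ v → ind (blockSorted r v) (q ^ inversions v * blockProduct r q v * F (ones v) (zeros v)))
      ≡⟨ Σw-++ r m _ ⟩
    Σw r (λ u → Σw m (λ w → ind (blockSorted r (u ++ᵥ w))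
      (q ^ inversions (u ++ᵥ w) * blockProduct r q (u ++ᵥ w) * F (ones (u ++ᵥ w)) (zeros (u ++ᵥ w)))))
      ≡⟨ sum-map-cong first-block (words r) ⟩
    Σw r (λ u → ind (sorted u) (blockWeight r q (ones u) * (q ^ inversions u * K (ones u) (zeros u))))
      ≡⟨ collapseBlock K ⟩
    Σw r (λ u → q ^ inversions u * K (ones u) (zeros u))
      ≡⟨ sum-map-cong (λ u → trans (sym (sum-map-*ˡ (q ^ inversions u) _ (words m)))
                                   (sum-map-cong (λ w → sym (term-++ u w)) (words m))) (words r) ⟩
    Σw r (λ u → Σw m (λ w → q ^ inversions (u ++ᵥ w) * F (ones (u ++ᵥ w)) (zeros (u ++ᵥ w))))
      ≡⟨ Σw-++ r m _ ⟨
    Σw (r + m) (λ v → q ^ inversions v * F (ones v) (zeros v))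
      ∎
    where
    open ≡-Reasoning
    shifted : ∀ {n} → Vec Bool n → ℕ → ℕ → ℕ
    shifted u a b = q ^ (ones u * b) * F (ones u + a) (zeros u + b)

    K : ℕ → ℕ → ℕ
    K a b = Σw m (λ w → q ^ inversions w * (q ^ (a * zeros w) * F (a + ones w) (b + zeros w)))

    term-++ : ∀ (u : Vec Bool r) (w : Vec Bool m) → q ^ inversions (u ++ᵥ w) * F (ones (u ++ᵥ w)) (zeros (u ++ᵥ w))
                                                  ≡ q ^ inversions u * (q ^ inversions w * shifted u (ones w) (zeros w))
    term-++ u w rewrite q^inversions-++ q u w | ones-++ u w | zeros-++ u w =
      rearrange (q ^ inversions u) (q ^ (ones u * zeros w)) (q ^ inversions w) (F (ones u + ones w) (zeros u + zeros w))
      where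
      rearrange : ∀ a c b f → a * c * b * f ≡ a * (b * (c * f))
      rearrange = solve-∀

    first-block : ∀ u → Σw m (λ w → ind (blockSorted r (u ++ᵥ w))
                          (q ^ inversions (u ++ᵥ w) * blockProduct r q (u ++ᵥ w) * F (ones (u ++ᵥ w)) (zeros (u ++ᵥ w))))
                      ≡ ind (sorted u) (blockWeight r q (ones u) * (q ^ inversions u * K (ones u) (zeros u)))
    first-block u = begin
      Σw m (λ w → ind (blockSorted r (u ++ᵥ w))
        (q ^ inversions (u ++ᵥ w) * blockProduct r q (u ++ᵥ w) * F (ones (u ++ᵥ w)) (zeros (u ++ᵥ w))))
        ≡⟨ sum-map-cong factor (words m) ⟩
      Σw m (λ w → ind (sorted u) (c * rest w))
        ≡⟨ sum-map-ind (sorted u) (λ w → c * rest w) (words m) ⟩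
      ind (sorted u) (Σw m (λ w → c * rest w))
        ≡⟨ cong (ind (sorted u)) (trans (sum-map-*ˡ c rest (words m)) (cong (c *_) (IH (shifted u)))) ⟩
      ind (sorted u) (c * K (ones u) (zeros u))
        ≡⟨ cong (ind (sorted u)) (*-assoc (blockWeight r q (ones u)) (q ^ inversions u) _) ⟩
      ind (sorted u) (blockWeight r q (ones u) * (q ^ inversions u * K (ones u) (zeros u)))
        ∎
      where
      c : ℕ
      c = blockWeight r q (ones u) * q ^ inversions u

      rest : Vec Bool m → ℕ
      rest w = ind (blockSorted r w) (q ^ inversions w * blockProduct r q w * shifted u (ones w) (zeros w))

      factor : ∀ w → ind (blockSorted r (u ++ᵥ w))
                       (q ^ inversions (u ++ᵥ w) * blockProduct r q (u ++ᵥ w) * F (ones (u ++ᵥ w)) (zeros (u ++ᵥ w)))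
                   ≡ ind (sorted u) (c * rest w)
      factor w rewrite blockSorted-++ r 1≤r u w | blockProduct-++ r 1≤r q u w
                     | q^inversions-++ q u w | ones-++ u w | zeros-++ u w =
        trans (ind-∧ (sorted u) (blockSorted r w) _)
              (cong (ind (sorted u))
                    (trans (cong (ind (blockSorted r w)) (rearrange (q ^ inversions u) (q ^ (ones u * zeros w))
                                                          (q ^ inversions w) (blockWeight r q (ones u)) (blockProduct r q w) _))
                           (ind-*ˡ (blockSorted r w) c _)))
        where
        rearrange : ∀ a c b g p f → a * c * b * (g * p) * f ≡ g * a * (b * p * (c * f))
        rearrange = solve-∀

  blockCollapse : ∀ n → BlockCollapse n
  blockCollapse = <-rec BlockCollapse collapse
    where
    collapse : ∀ n → (∀ {m} → m < n → BlockCollapse m) → BlockCollapse n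
    collapse n rec with n <? r
    ... | yes n<r = blockCollapse-short n<r
    ... | no  n≮r = subst BlockCollapse (m+[n∸m]≡n r≤n) (blockCollapse-step (rec (∸-monoʳ-< 1≤r r≤n)))
      where
      r≤n : r ≤ n
      r≤n = ≮⇒≥ n≮r

corollary4p3 : (r n k : ℕ) → 1 ≤ r → k ≤ n → (q : ℕ) → gauss n k q ≡ rhs r n k q
corollary4p3 r n k 1≤r k≤n q = begin
  gauss n k q
    ≡⟨ gauss≡invSum q k≤n ⟩
  invSum q n k
    ≡⟨ sum-map-cong (λ v → trans (cong (ind (ones v ≡ᵇ k)) (sym (*-identityʳ (q ^ inversions v))))
                                 (ind-*ˡ (ones v ≡ᵇ k) (q ^ inversions v) 1)) (words n) ⟩
  Σw n (λ v → q ^ inversions v * F (ones v) (zeros v))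
    ≡⟨ blockCollapse r q 1≤r n F ⟨
  Σw n (λ v → ind (blockSorted r v) (q ^ inversions v * blockProduct r q v * F (ones v) (zeros v)))
    ≡⟨ sum-map-cong in-Ω (words n) ⟩
  Σw n (λ v → ind (inOmega r k v) (weight r q v))
    ≡⟨ sum-map-filterᵇ (inOmega r k) (weight r q) (words n) ⟨
  rhs r n k q
    ∎
  where
  open ≡-Reasoning
  F : ℕ → ℕ → ℕ
  F a _ = ind (a ≡ᵇ k) 1

  in-Ω : ∀ v → ind (blockSorted r v) (q ^ inversions v * blockProduct r q v * F (ones v) (zeros v))
             ≡ ind (inOmega r k v) (weight r q v)
  in-Ω v rewrite inv≡inversions v with ones v ≡ᵇ k
  ... | true  = cong (ind (blockSorted r v)) (*-identityʳ (q ^ inversions v * blockProduct r q v))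
  ... | false = trans (cong (ind (blockSorted r v)) (*-zeroʳ (q ^ inversions v * blockProduct r q v))) (ind-0 (blockSorted r v))
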